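{- Let $N$ and $v$ be integers with $3\le v<N$, let $f=\lfloor\frac{N+1}{v}\rfloor$ and $d=(f+1)v-N$, and let $s=\sum_{i=f-d+2}^{f-1}(d-f-1+i)\binom{N}{i}$ and $s'=\sum_{i=f-v+1}^{f-2}(v-f+i)\binom{N}{i}$. Then (1) $\lfloor\frac1d(\binom{N}{f}-s)\rfloor\ge0$ when $N\not\equiv v-1\pmod v$; and (2) $\binom{N}{f-1}-2\lceil\frac{s'}{v+1}\rceil\ge0$ when $N\equiv v-1\pmod v$.
   Context: $\binom{N}{j}=0$ for $j<0$ and empty sums are $0$. -}

module Defs where

open import Data.Nat as ℕ using (ℕ; zero; suc)
open import Data.Nat.Combinatorics using (_C_)
open import Data.Integer using (ℤ; +_; -[1+_]; _+_; _-_; -_; _/ℕ_; 0ℤ)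

-- floor division of natural numbers (v = 0 never arises in use; junk value 0)
_⌊/⌋_ : ℕ → ℕ → ℕ
n ⌊/⌋ zero = 0
n ⌊/⌋ suc k = n ℕ./ suc k

-- floor(x / y) for integers x and y > 0 (junk value 0 if y ≤ 0, never used)
floorDiv : ℤ → ℤ → ℤ
floorDiv x (+ suc k) = x /ℕ suc k
floorDiv x _ = 0ℤ

ceilDiv : ℤ → ℤ → ℤ
ceilDiv x y = - floorDiv (- x) y

binomℤ : ℕ → ℤ → ℤ
binomℤ N (+ j) = + (N C j)
binomℤ N -[1+ _ ] = 0ℤ

-- Σ_{i=a}^{b} g i over integers; empty sum (b < a) is 0
sumFromTo : ℤ → ℤ → (ℤ → ℤ) → ℤ
sumFromTo a b g = go (len (b - a + + 1))
  where
  len : ℤ → ℕ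
  len (+ n) = n
  len -[1+ _ ] = 0
  go : ℕ → ℤ
  go zero = 0ℤ
  go (suc k) = go k + g (a + + k)

-- remainder of n modulo v (v = 0 never arises in use; junk value n)
_mod′_ : ℕ → ℕ → ℕ
n mod′ zero = n
n mod′ suc k = n ℕ.% suc k

module Submission where

-- Write N = q v + r with r < v.  Both s and s' are weighted sums  Σ_{m<n} (m+1) C(N, q-n+m)  of the
-- binomial coefficients just below C(N,q), with n ≤ v - 2.  Below index q consecutive binomial
-- coefficients grow by a factor of at least v - 1, so an induction on n gives
-- (v - 2) · (weighted sum) ≤ n · C(N,q) ≤ (v - 2) · C(N,q): both sums are at most C(N,q).
-- In case (1) f = q and d = v - r ≥ 2, so the floor is taken of a non-negative number.
-- In case (2) f = q + 1, and v < N forces q ≥ 1, hence C(N,q) ≥ 2; this absorbs the rounding in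
-- 2 ⌈s'/(v+1)⌉ ≤ 2 (1 + ⌊C(N,q)/4⌋) ≤ C(N,q).

module _ where
  open import Data.Nat
  open import Data.Nat.Properties
  open import Data.Nat.Combinatorics using (_C_; nCk+nC[k+1]≡[n+1]C[k+1]; nC1≡n)
  open import Data.Nat.DivMod using (_/_; _%_; +-distrib-/; m<n⇒m/n≡0; m*n/n≡m; m<n⇒m%n≡m; m*n%n≡0; m/n*n≤m)
  open import Data.Nat.Tactic.RingSolver using (solve-∀)
  open import Relation.Binary.PropositionalEquality

  weighted : (ℕ → ℕ) → ℕ → ℕ
  weighted x zero    = 0
  weighted x (suc n) = weighted x n + suc n * x n

  weighted-bound : ∀ w x n → (∀ m → m < n → suc w * x m ≤ x (suc m)) →
                   w * weighted x n ≤ n * x n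
  weighted-bound w x zero    grows = ≤-reflexive (*-zeroʳ w)
  weighted-bound w x (suc n) grows = begin
    w * (weighted x n + suc n * x n)          ≡⟨ *-distribˡ-+ w (weighted x n) _ ⟩
    w * weighted x n + w * (suc n * x n)      ≤⟨ +-monoˡ-≤ _ (weighted-bound w x n (λ m m<n → grows m (m≤n⇒m≤1+n m<n))) ⟩
    n * x n + w * (suc n * x n)               ≤⟨ +-monoˡ-≤ _ (*-monoˡ-≤ (x n) (n≤1+n n)) ⟩
    suc n * x n + w * (suc n * x n)           ≡⟨ regroup (suc n) w (x n) ⟩
    suc n * (suc w * x n)                     ≤⟨ *-monoʳ-≤ (suc n) (grows n ≤-refl) ⟩
    suc n * x (suc n)                         ∎
    where
    open ≤-Reasoning
    regroup : ∀ m w y → m * y + w * (m * y) ≡ m * (suc w * y)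
    regroup = solve-∀

  -- The absorption identity (k+1) C(n,k+1) = (n-k) C(n,k), stated without truncated subtraction.
  [1+k]*nC[1+k]+k*nCk≡n*nCk : ∀ n k → suc k * (n C suc k) + k * (n C k) ≡ n * (n C k)
  [1+k]*nC[1+k]+k*nCk≡n*nCk zero    zero    = refl
  [1+k]*nC[1+k]+k*nCk≡n*nCk zero    (suc k) = cong₂ _+_ (*-zeroʳ (suc (suc k))) (*-zeroʳ (suc k))
  [1+k]*nC[1+k]+k*nCk≡n*nCk (suc n) zero    rewrite nC1≡n (suc n) = trans (+-identityʳ (1 * suc n)) (*-comm 1 (suc n))
  [1+k]*nC[1+k]+k*nCk≡n*nCk (suc n) (suc k) = begin
    suc (suc k) * (suc n C suc (suc k)) + suc k * (suc n C suc k)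
      ≡⟨ cong₂ (λ u v → suc (suc k) * u + suc k * v) (sym (nCk+nC[k+1]≡[n+1]C[k+1] n (suc k))) (sym (nCk+nC[k+1]≡[n+1]C[k+1] n k)) ⟩
    suc (suc k) * (b + c) + suc k * (a + b)
      ≡⟨ regroup k a b c ⟩
    (suc (suc k) * c + suc k * b) + (suc k * b + k * a) + (a + b)
      ≡⟨ cong₂ (λ u v → u + v + (a + b)) ([1+k]*nC[1+k]+k*nCk≡n*nCk n (suc k)) ([1+k]*nC[1+k]+k*nCk≡n*nCk n k) ⟩
    n * b + n * a + (a + b)
      ≡⟨ collect n a b ⟩
    suc n * (a + b)
      ≡⟨ cong (suc n *_) (nCk+nC[k+1]≡[n+1]C[k+1] n k) ⟩
    suc n * (suc n C suc k)
      ∎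
    where
    open ≡-Reasoning
    a = n C k
    b = n C suc k
    c = n C suc (suc k)
    regroup : ∀ k a b c → suc (suc k) * (b + c) + suc k * (a + b) ≡ (suc (suc k) * c + suc k * b) + (suc k * b + k * a) + (a + b)
    regroup = solve-∀
    collect : ∀ n a b → n * b + n * a + (a + b) ≡ suc n * (a + b)
    collect = solve-∀

  [1+j]*w+j≤[1+j]*[1+w] : ∀ j w → suc j * w + j ≤ suc j * suc w
  [1+j]*w+j≤[1+j]*[1+w] j w = ≤-trans (m≤m+n _ 1) (≤-reflexive (expand j w))
    where
    expand : ∀ j w → suc j * w + j + 1 ≡ suc j * suc w
    expand = solve-∀

  binom-growth : ∀ n j w → suc j * w + j ≤ n → w * (n C j) ≤ n C suc j
  binom-growth n j w j-small = *-cancelˡ-≤ (suc j) (+-cancelʳ-≤ (j * (n C j)) _ _ (begin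
    suc j * (w * (n C j)) + j * (n C j)   ≡⟨ regroup j w (n C j) ⟩
    (suc j * w + j) * (n C j)             ≤⟨ *-monoˡ-≤ (n C j) j-small ⟩
    n * (n C j)                           ≡⟨ [1+k]*nC[1+k]+k*nCk≡n*nCk n j ⟨
    suc j * (n C suc j) + j * (n C j)     ∎))
    where
    open ≤-Reasoning
    regroup : ∀ j w c → suc j * (w * c) + j * c ≡ (suc j * w + j) * c
    regroup = solve-∀

  1≤nCk : ∀ {n k} → k ≤ n → 1 ≤ n C k
  1≤nCk {k = zero}      _         = ≤-refl
  1≤nCk {suc n} {suc k} (s≤s k≤n) = begin
    1                   ≤⟨ 1≤nCk k≤n ⟩
    n C k               ≤⟨ m≤m+n (n C k) _ ⟩
    n C k + n C suc k   ≡⟨ nCk+nC[k+1]≡[n+1]C[k+1] n k ⟩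
    suc n C suc k       ∎
    where open ≤-Reasoning

  2≤nC[1+k] : ∀ n k → suc k * 3 ≤ n → 2 ≤ n C suc k
  2≤nC[1+k] n k k-small = begin
    2               ≤⟨ *-monoʳ-≤ 2 (1≤nCk (≤-trans (n≤1+n k) (≤-trans (m≤m*n (suc k) 3) k-small))) ⟩
    2 * (n C k)     ≤⟨ binom-growth n k 2 (≤-trans ([1+j]*w+j≤[1+j]*[1+w] k 2) k-small) ⟩
    n C suc k       ∎
    where open ≤-Reasoning

  [r+q*n]/n≡q : ∀ r q n .{{_ : NonZero n}} → r < n → (r + q * n) / n ≡ q
  [r+q*n]/n≡q r q n r<n =
    trans (+-distrib-/ r (q * n) remainders) (cong₂ _+_ (m<n⇒m/n≡0 r<n) (m*n/n≡m q n))
    where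
    open ≤-Reasoning
    remainders : r % n + q * n % n < n
    remainders = begin-strict
      r % n + q * n % n   ≡⟨ cong₂ _+_ (m<n⇒m%n≡m r<n) (m*n%n≡0 q n) ⟩
      r + 0               ≡⟨ +-identityʳ r ⟩
      r                   <⟨ r<n ⟩
      n                   ∎

  2*[1+n/4]≤n : ∀ n → 2 ≤ n → 2 * suc (n / 4) ≤ n
  2*[1+n/4]≤n n 2≤n = 2*[1+m]≤n (n / 4) (m/n*n≤m n 4)
    where
    2*[1+m]≤n : ∀ m → m * 4 ≤ n → 2 * suc m ≤ n
    2*[1+m]≤n zero    _    = 2≤n
    2*[1+m]≤n (suc m) 4m≤n = ≤-trans (≤-trans (m≤m+n _ (2 * m)) (≤-reflexive (expand m))) 4m≤n
      where
      expand : ∀ m → 2 * suc (suc m) + 2 * m ≡ suc m * 4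
      expand = solve-∀

open import Defs
open import Data.Nat as ℕ using (ℕ; zero; suc; z≤n; s≤s)
open import Data.Nat.Combinatorics using (_C_)
import Data.Nat.Properties as ℕ
open import Data.Integer using (ℤ; +_; -[1+_]; _+_; _-_; _*_; _⊖_; _≤_; _<_; 0ℤ; +≤+; +<+)
import Data.Integer.Properties as ℤ
open import Data.Integer.DivMod using (0≤n⇒0≤n/ℕd)
open import Data.Nat.DivMod using (/-mono-≤; m≡m%n+[m/n]*n; m%n<n; m≥n⇒m/n>0)
open import Data.Integer.Tactic.RingSolver using (solve-∀)
open import Data.Product using (_×_; _,_)
open import Relation.Binary.PropositionalEquality
open import Relation.Nullary using (¬_)

choose : ℕ → ℤ → ℕ
choose N (+ j)     = N C j
choose N -[1+ _ ] = 0

binomℤ≡+choose : ∀ N i → binomℤ N i ≡ + choose N i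
binomℤ≡+choose N (+ j)     = refl
binomℤ≡+choose N -[1+ _ ] = refl

choose-growth : ∀ N w q i → q ℕ.* suc w ℕ.≤ N → + 1 + i ≤ + q →
                w ℕ.* choose N i ℕ.≤ choose N (+ 1 + i)
choose-growth N w q -[1+ _ ] _    _                = ℕ.≤-trans (ℕ.≤-reflexive (ℕ.*-zeroʳ w)) z≤n
choose-growth N w q (+ j)    qw≤N (+≤+ 1+j≤q) =
  binom-growth N j w (ℕ.≤-trans ([1+j]*w+j≤[1+j]*[1+w] j w) (ℕ.≤-trans (ℕ.*-monoˡ-≤ (suc w) 1+j≤q) qw≤N))

weighted-choose≤ : ∀ N w q a n → q ℕ.* (2 ℕ.+ w) ℕ.≤ N → a + + n ≡ + q → n ℕ.≤ w →
                   weighted (λ m → choose N (a + + m)) n ℕ.≤ N C q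
weighted-choose≤ N zero     q a zero qw≤N top z≤n = z≤n
weighted-choose≤ N (suc w) q a n qw≤N top n≤w = ℕ.*-cancelˡ-≤ (suc w) (begin
  suc w ℕ.* weighted x n   ≤⟨ weighted-bound (suc w) x n grows ⟩
  n ℕ.* x n                ≡⟨ cong (λ i → n ℕ.* choose N i) top ⟩
  n ℕ.* (N C q)            ≤⟨ ℕ.*-monoˡ-≤ (N C q) n≤w ⟩
  suc w ℕ.* (N C q)        ∎)
  where
  open ℕ.≤-Reasoning
  x : ℕ → ℕ
  x m = choose N (a + + m)
  shift : ∀ a m → + 1 + (a + m) ≡ a + (+ 1 + m)
  shift = solve-∀
  grows : ∀ m → m ℕ.< n → suc (suc w) ℕ.* x m ℕ.≤ x (suc m)
  grows m m<n = subst (λ i → suc (suc w) ℕ.* x m ℕ.≤ choose N i) (shift a (+ m))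
    (choose-growth N (suc (suc w)) q (a + + m) qw≤N
      (subst (_≤ + q) (sym (shift a (+ m))) (subst (a + + suc m ≤_) top (ℤ.+-monoʳ-≤ a (+≤+ m<n)))))

length-pred : ∀ a b n → b - a + + 1 ≡ + suc n → b - + 1 - a + + 1 ≡ + n
length-pred a b n len = trans (regroup a b) (cong (_- + 1) len)
  where
  regroup : ∀ a b → b - + 1 - a + + 1 ≡ b - a + + 1 - + 1
  regroup = solve-∀

sumFromTo-step : ∀ a b g n → b - a + + 1 ≡ + suc n →
                 sumFromTo a b g ≡ sumFromTo a (b - + 1) g + g (a + + n)
-- refl: the summation loop inside sumFromTo does not depend on the upper bound b, only on the length.
sumFromTo-step a b g n len rewrite len | length-pred a b n len = refl

sumFromTo-weighted : ∀ N a b c n → c + a ≡ + 1 → b - a + + 1 ≡ + n →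
  sumFromTo a b (λ i → (c + i) * binomℤ N i) ≡ + weighted (λ m → choose N (a + + m)) n
sumFromTo-weighted N a b c zero    _      len rewrite len = refl
sumFromTo-weighted N a b c (suc n) weight len = begin
  sumFromTo a b g                                 ≡⟨ sumFromTo-step a b g n len ⟩
  sumFromTo a (b - + 1) g + g (a + + n)           ≡⟨ cong₂ _+_ (sumFromTo-weighted N a (b - + 1) c n weight (length-pred a b n len))
                                                                (cong₂ _*_ coefficient (binomℤ≡+choose N (a + + n))) ⟩
  + weighted x n + + suc n * + x n                ≡⟨ cong (_+_ (+ weighted x n)) (ℤ.pos-* (suc n) (x n)) ⟨
  + weighted x (suc n)                            ∎
  where
  open ≡-Reasoning
  g : ℤ → ℤ
  g i = (c + i) * binomℤ N i
  x : ℕ → ℕ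
  x m = choose N (a + + m)
  coefficient : c + (a + + n) ≡ + suc n
  coefficient = trans (sym (ℤ.+-assoc c a (+ n))) (cong (_+ + n) weight)

floorDiv-nonNeg : ∀ x y → 0ℤ ≤ x → 0ℤ < y → 0ℤ ≤ floorDiv x y
floorDiv-nonNeg x (+ suc k) 0≤x _ = 0≤n⇒0≤n/ℕd x (suc k) 0≤x
floorDiv-nonNeg x (+ zero) _ (+<+ ())

ceilDiv≤1+floor : ∀ S D → ceilDiv (+ S) (+ suc D) ≤ + suc (S ℕ./ suc D)
ceilDiv≤1+floor zero    D = +≤+ z≤n
ceilDiv≤1+floor (suc n) D with suc n ℕ.% suc D
... | zero  = ℤ.≤-trans (ℤ.≤-reflexive (ℤ.neg-involutive _)) (+≤+ (ℕ.n≤1+n _))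
... | suc _ = ℤ.≤-refl

2*ceilDiv≤ : ∀ S K D → 3 ℕ.≤ D → S ℕ.≤ K → 2 ℕ.≤ K → 0ℤ ≤ + K - + 2 * ceilDiv (+ S) (+ suc D)
2*ceilDiv≤ S K D 3≤D S≤K 2≤K = ℤ.i≤j⇒0≤j-i (begin
  + 2 * ceilDiv (+ S) (+ suc D)   ≤⟨ ℤ.*-monoˡ-≤-nonNeg (+ 2) (ceilDiv≤1+floor S D) ⟩
  + 2 * + suc (S ℕ./ suc D)       ≤⟨ ℤ.*-monoˡ-≤-nonNeg (+ 2) (+≤+ (s≤s (/-mono-≤ S≤K (s≤s 3≤D)))) ⟩
  + (2 ℕ.* suc (K ℕ./ 4))         ≤⟨ +≤+ (2*[1+n/4]≤n K 2≤K) ⟩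
  + K                             ∎)
  where open ℤ.≤-Reasoning

lemma5p1-floorCase : ∀ N w q L → q ℕ.* (2 ℕ.+ w) ℕ.≤ N → L ℕ.≤ w → (f d : ℤ) → f ≡ + q → d ≡ + (2 ℕ.+ L) →
  0ℤ ≤ floorDiv (binomℤ N f - sumFromTo (f - d + + 2) (f - + 1) (λ i → (d - f - + 1 + i) * binomℤ N i)) d
lemma5p1-floorCase N w q L qv≤N L≤w _ _ refl refl =
  floorDiv-nonNeg _ _ (ℤ.i≤j⇒0≤j-i (ℤ.≤-trans (ℤ.≤-reflexive sum≡weighted) (+≤+ weighted≤))) (+<+ (s≤s z≤n))
  where
  a : ℤ
  a = + q - + (2 ℕ.+ L) + + 2
  weights : ∀ Q L → (+ 2 + L - Q - + 1) + (Q - (+ 2 + L) + + 2) ≡ + 1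
  weights = solve-∀
  length : ∀ Q L → Q - + 1 - (Q - (+ 2 + L) + + 2) + + 1 ≡ L
  length = solve-∀
  top : ∀ Q L → Q - (+ 2 + L) + + 2 + L ≡ Q
  top = solve-∀
  sum≡weighted : sumFromTo a (+ q - + 1) (λ i → (+ (2 ℕ.+ L) - + q - + 1 + i) * binomℤ N i)
               ≡ + weighted (λ m → choose N (a + + m)) L
  sum≡weighted = sumFromTo-weighted N a (+ q - + 1) (+ (2 ℕ.+ L) - + q - + 1) L (weights (+ q) (+ L)) (length (+ q) (+ L))
  weighted≤ : weighted (λ m → choose N (a + + m)) L ℕ.≤ N C q
  weighted≤ = weighted-choose≤ N w q a L qv≤N (top (+ q) (+ L)) L≤w

lemma5p1-ceilCase : ∀ N v q → 3 ℕ.≤ v → 1 ℕ.≤ q → q ℕ.* v ℕ.≤ N → (f : ℤ) → f ≡ + suc q →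
  0ℤ ≤ binomℤ N (f - + 1)
       - + 2 * ceilDiv (sumFromTo (f - + v + + 1) (f - + 2) (λ i → (+ v - f + i) * binomℤ N i)) (+ v + + 1)
lemma5p1-ceilCase N (suc (suc (suc k))) q@(suc p) (s≤s (s≤s (s≤s z≤n))) (s≤s z≤n) qv≤N _ refl =
  subst (λ s → 0ℤ ≤ + (N C q) - + 2 * ceilDiv s (+ (3 ℕ.+ k) + + 1)) (sym sum≡weighted)
    (2*ceilDiv≤ _ (N C q) (2 ℕ.+ (k ℕ.+ 1)) (s≤s (s≤s (ℕ.m≤n+m 1 k))) weighted≤ 2≤nCq)
  where
  F : ℤ
  F = + suc q
  a : ℤ
  a = F - + (3 ℕ.+ k) + + 1
  weights : ∀ F V → (V - F) + (F - V + + 1) ≡ + 1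
  weights = solve-∀
  length : ∀ F k → F - + 2 - (F - (+ 3 + k) + + 1) + + 1 ≡ + 1 + k
  length = solve-∀
  top : ∀ F k → F - (+ 3 + k) + + 1 + (+ 1 + k) ≡ F - + 1
  top = solve-∀
  sum≡weighted : sumFromTo a (F - + 2) (λ i → (+ (3 ℕ.+ k) - F + i) * binomℤ N i)
               ≡ + weighted (λ m → choose N (a + + m)) (suc k)
  sum≡weighted = sumFromTo-weighted N a (F - + 2) (+ (3 ℕ.+ k) - F) (suc k) (weights F (+ (3 ℕ.+ k))) (length F (+ k))
  weighted≤ : weighted (λ m → choose N (a + + m)) (suc k) ℕ.≤ N C q
  weighted≤ = weighted-choose≤ N (suc k) q a (suc k) qv≤N (top F (+ k)) ℕ.≤-refl
  2≤nCq : 2 ℕ.≤ N C q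
  2≤nCq = 2≤nC[1+k] N p (ℕ.≤-trans (ℕ.*-monoʳ-≤ q (s≤s (s≤s (s≤s z≤n)))) qv≤N)

lemma5p1 : (N v : ℕ) → 3 ℕ.≤ v → v ℕ.< N →
    let f : ℤ
        f = + ((N ℕ.+ 1) ⌊/⌋ v)
        d : ℤ
        d = (f + + 1) * + v - + N
        s : ℤ
        s = sumFromTo (f - d + + 2) (f - + 1) (λ i → (d - f - + 1 + i) * binomℤ N i)
        s' : ℤ
        s' = sumFromTo (f - + v + + 1) (f - + 2) (λ i → (+ v - f + i) * binomℤ N i)
    in (¬ (N mod′ v ≡ v ℕ.∸ 1) → 0ℤ ≤ floorDiv (binomℤ N f - s) d)
       × (N mod′ v ≡ v ℕ.∸ 1 → 0ℤ ≤ binomℤ N (f - + 1) - + 2 * ceilDiv s' (+ v + + 1))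
lemma5p1 N v@(suc (suc (suc k))) 3≤v@(s≤s (s≤s (s≤s z≤n))) v<N =
    (λ r≢v∸1 → let r≤1+k = ℕ.s≤s⁻¹ (ℕ.≤∧≢⇒< (ℕ.s≤s⁻¹ (m%n<n N v)) r≢v∸1) in
      lemma5p1-floorCase N (suc k) q (suc k ℕ.∸ r) qv≤N (ℕ.m∸n≤m (suc k) r) _ _
        (cong +_ ([N+1]/v≡q r≤1+k)) (d≡ r≤1+k))
  , (λ r≡v∸1 → lemma5p1-ceilCase N v q 3≤v (m≥n⇒m/n>0 (ℕ.<⇒≤ v<N)) qv≤N _ (cong +_ ([N+1]/v≡1+q r≡v∸1)))
  where
  q r : ℕ
  q = N ℕ./ v
  r = N ℕ.% v
  N≡r+q*v : N ≡ r ℕ.+ q ℕ.* v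
  N≡r+q*v = m≡m%n+[m/n]*n N v
  qv≤N : q ℕ.* v ℕ.≤ N
  qv≤N = subst (q ℕ.* v ℕ.≤_) (sym N≡r+q*v) (ℕ.m≤n+m _ r)
  N+1≡1+r+q*v : N ℕ.+ 1 ≡ suc r ℕ.+ q ℕ.* v
  N+1≡1+r+q*v = trans (ℕ.+-comm N 1) (cong suc N≡r+q*v)
  [N+1]/v≡q : r ℕ.≤ suc k → (N ℕ.+ 1) ℕ./ v ≡ q
  [N+1]/v≡q r≤1+k = trans (cong (ℕ._/ v) N+1≡1+r+q*v) ([r+q*n]/n≡q (suc r) q v (s≤s (s≤s r≤1+k)))
  [N+1]/v≡1+q : r ≡ 2 ℕ.+ k → (N ℕ.+ 1) ℕ./ v ≡ suc q
  [N+1]/v≡1+q r≡v∸1 = trans (cong (ℕ._/ v) (trans N+1≡1+r+q*v (cong (λ t → suc t ℕ.+ q ℕ.* v) r≡v∸1)))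
                        ([r+q*n]/n≡q 0 (suc q) v (s≤s z≤n))
  d≡ : r ℕ.≤ suc k → (+ ((N ℕ.+ 1) ℕ./ v) + + 1) * + v - + N ≡ + (2 ℕ.+ (suc k ℕ.∸ r))
  d≡ r≤1+k = begin
    (+ ((N ℕ.+ 1) ℕ./ v) + + 1) * + v - + N  ≡⟨ cong₂ (λ t u → (+ t + + 1) * + v - + u) ([N+1]/v≡q r≤1+k) N≡r+q*v ⟩
    (+ q + + 1) * + v - + (r ℕ.+ q ℕ.* v)   ≡⟨ cong (λ t → (+ q + + 1) * + v - (+ r + t)) (ℤ.pos-* q v) ⟩
    (+ q + + 1) * + v - (+ r + + q * + v)   ≡⟨ cancel (+ q) (+ r) (+ v) ⟩
    + v - + r                               ≡⟨ ℤ.m-n≡m⊖n v r ⟩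
    v ⊖ r                                   ≡⟨ ℤ.⊖-≥ (ℕ.m≤n⇒m≤1+n (ℕ.m≤n⇒m≤1+n r≤1+k)) ⟩
    + (v ℕ.∸ r)                             ≡⟨ cong +_ (ℕ.+-∸-assoc 2 r≤1+k) ⟩
    + (2 ℕ.+ (suc k ℕ.∸ r))                 ∎
    where
    open ≡-Reasoning
    cancel : ∀ q r v → (q + + 1) * v - (r + q * v) ≡ v - r
    cancel = solve-∀
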